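{- Let $p$ be an odd prime, let $k\in\mathbb{N}_{+}$ with $p^{2}(p-1)\mid k$, and let $r\in\{1,\ldots,p-2\}$. Let $A_{p,k-r}(n)$ be defined by $$\prod_{m=0}^{\infty}\frac{1}{\left(1-x^{p^{m}}\right)^{k-r}}=\sum_{n=0}^{\infty}A_{p,k-r}(n)x^{n}.$$ Then there are infinitely many $n\in\mathbb{N}_{+}$ such that $\nu_{p}(A_{p,k-r}(n))\geq \nu_{p}(k)$.
   Context: $\mathbb{N}_{+}=\{1,2,\ldots\}$. $\nu_{p}(m)$ denotes the $p$-adic valuation of an integer $m$ (largest $t$ with $p^t\mid m$), with $\nu_p(0)=+\infty$. -}

module Defs where

open import Data.Nat using (ℕ; zero; suc; _+_; _*_; _∸_; _^_)
open import Data.Nat.Divisibility using (_∣_; _∣?_)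
open import Data.List using (map; upTo)
open import Data.Nat.ListAction using (sum)
open import Relation.Nullary using (yes; no)

Series : Set
Series = ℕ → ℕ

one : Series
one zero    = 1
one (suc _) = 0

_⊛_ : Series → Series → Series
(f ⊛ g) n = sum (map (λ i → f i * g (n ∸ i)) (upTo (suc n)))

-- 1/(1 - x^q) = Σ_j x^{q j}  (geometric series); coefficient of x^n is 1 iff q ∣ n.
geomInv : ℕ → Series
geomInv q n with q ∣? n
... | yes _ = 1
... | no  _ = 0

powS : ℕ → Series → Series
powS zero    f = one
powS (suc s) f = f ⊛ powS s f

prodUpTo : ℕ → ℕ → ℕ → Series
prodUpTo p s zero    = powS s (geomInv 1)
prodUpTo p s (suc M) = prodUpTo p s M ⊛ powS s (geomInv (p ^ suc M))

-- A_{p,s}(n): coefficient of x^n in Π_{m=0}^{∞} 1/(1 - x^{p^m})^s.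
-- For p ≥ 2 the factors with m > n are ≡ 1 mod x^{n+1} (p^m > n), so the
-- coefficient of x^n equals that of the truncated product over m = 0..n.
A : ℕ → ℕ → ℕ → ℕ
A p s n = prodUpTo p s n n

-- ν_p(a) ≥ ν_p(b), unfolded: every power of p dividing b divides a
-- (with ν_p(0) = +∞ this matches the convention in the paper).
ν[_]_≥ν_ : ℕ → ℕ → ℕ → Set
ν[ p ] a ≥ν b = ∀ t → p ^ t ∣ b → p ^ t ∣ a

{-# OPTIONS --safe #-}
-- With B s the coefficients of (1 − x)^(−s), the absorption identity
-- (n + 1)·B s (n + 1) = s·B (s + 1) n shows that p^t ∣ k forces p^t ∣ B k n
-- whenever n ≢ 0 (mod p).  Pascal's rule B s (n + 1) = B (s + 1) (n + 1) − B (s + 1) n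
-- then lowers k one step at a time at the price of one residue class: for r < p,
-- p^t divides B (k − r) n whenever n mod p > r.  All other factors
-- (1 − x^(p^m))^(−s) of the product are series in x^p, and multiplying by such a
-- series does not mix residue classes mod p.  Hence every n ≡ −1 (mod p) works;
-- of the hypotheses on p and k only p^ν(k) ∣ k and r ≤ k are needed.
module Submission where

open import Defs
open import Data.Nat using (ℕ; zero; suc; _+_; _*_; _∸_; _^_; _≤_; _<_; s≤s; NonZero; _%_; _/_)
open import Data.Nat.Properties
open import Data.Nat.Divisibility
open import Data.Nat.DivMod using (m≡m%n+[m/n]*n; [m+kn]%n≡m%n; m<n⇒m%n≡m)
open import Data.Nat.Primality using (Prime; euclidsLemma; prime⇒nonZero)
open import Data.Nat.ListAction using (sum)
open import Data.List using (List; map; upTo; applyUpTo)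
open import Data.List.Properties using (map-cong; map-upTo; map-applyUpTo)
open import Data.List.Relation.Unary.All using (All; []; _∷_)
open import Data.List.Relation.Unary.All.Properties using (map⁺; applyUpTo⁺₁)
open import Data.Product using (∃; _×_; _,_)
open import Data.Sum using (_⊎_; inj₁; inj₂)
open import Data.Empty using (⊥-elim)
open import Relation.Nullary using (¬_; yes; no)
open import Relation.Binary.PropositionalEquality using (_≡_; _≢_; refl; sym; trans; cong; cong₂; subst; module ≡-Reasoning)
open import Function using (_∘_)
open ≡-Reasoning

∣-sum : ∀ {d} {ns : List ℕ} → All (d ∣_) ns → d ∣ sum ns
∣-sum []         = _ ∣0
∣-sum (d∣n ∷ ds) = ∣m∣n⇒∣m+n d∣n (∣-sum ds)

∣-⊛ : ∀ {d} (f g : Series) n → (∀ i → i ≤ n → d ∣ f i ⊎ d ∣ g (n ∸ i)) → d ∣ (f ⊛ g) n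
∣-⊛ f g n split = ∣-sum (map⁺ (applyUpTo⁺₁ _ (suc n) (term ∘ m<1+n⇒m≤n)))
  where
  term : ∀ {i} → i ≤ n → _ ∣ f i * g (n ∸ i)
  term {i} i≤n with split i i≤n
  ... | inj₁ d∣f = ∣m⇒∣m*n (g (n ∸ i)) d∣f
  ... | inj₂ d∣g = ∣n⇒∣m*n (f i) d∣g

geomInv-1 : ∀ n → geomInv 1 n ≡ 1
geomInv-1 n with 1 ∣? n
... | yes _   = refl
... | no 1∤n = ⊥-elim (1∤n (1∣ n))

geomInv-1⊛-suc : ∀ f n → (geomInv 1 ⊛ f) (suc n) ≡ f (suc n) + (geomInv 1 ⊛ f) n
geomInv-1⊛-suc f n = cong₂ _+_ head (begin
  sum (map term (applyUpTo suc (suc n)))  ≡⟨ cong sum (map-applyUpTo suc term (suc n)) ⟩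
  sum (applyUpTo (term ∘ suc) (suc n))    ≡⟨ cong sum (sym (map-upTo (term ∘ suc) (suc n))) ⟩
  sum (map (term ∘ suc) (upTo (suc n)))   ≡⟨ cong sum (map-cong shift (upTo (suc n))) ⟩
  (geomInv 1 ⊛ f) n                       ∎)
  where
  term : ℕ → ℕ
  term i = geomInv 1 i * f (suc n ∸ i)
  head : term 0 ≡ f (suc n)
  head = trans (cong (_* f (suc n)) (geomInv-1 0)) (*-identityˡ _)
  shift : ∀ i → term (suc i) ≡ geomInv 1 i * f (n ∸ i)
  shift i = cong (_* f (n ∸ i)) (trans (geomInv-1 (suc i)) (sym (geomInv-1 i)))

negBinom : ℕ → Series
negBinom s = powS s (geomInv 1)

negBinom-zero : ∀ s → negBinom s 0 ≡ 1
negBinom-zero zero    = refl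
negBinom-zero (suc s) = begin
  geomInv 1 0 * negBinom s 0 + 0  ≡⟨ +-identityʳ _ ⟩
  geomInv 1 0 * negBinom s 0      ≡⟨ cong₂ _*_ (geomInv-1 0) (negBinom-zero s) ⟩
  1                               ∎

negBinom-pascal : ∀ s n → negBinom (suc s) (suc n) ≡ negBinom s (suc n) + negBinom (suc s) n
negBinom-pascal s = geomInv-1⊛-suc (negBinom s)

negBinom-absorption : ∀ s n → suc n * negBinom s (suc n) ≡ s * negBinom (suc s) n
negBinom-absorption zero    n    = *-zeroʳ (suc n)
negBinom-absorption (suc s) zero = begin
  1 * negBinom (suc s) 1                      ≡⟨ *-identityˡ _ ⟩
  negBinom (suc s) 1                          ≡⟨ negBinom-pascal s 0 ⟩
  negBinom s 1 + negBinom (suc s) 0           ≡⟨ cong₂ _+_ (trans (sym (*-identityˡ _)) (negBinom-absorption s 0))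
                                                           (negBinom-zero (suc s)) ⟩
  s * negBinom (suc s) 0 + 1                  ≡⟨ cong (λ b → s * b + 1) (negBinom-zero (suc s)) ⟩
  s * 1 + 1                                   ≡⟨ +-comm (s * 1) 1 ⟩
  suc s * 1                                   ≡⟨ cong (suc s *_) (sym (negBinom-zero (suc (suc s)))) ⟩
  suc s * negBinom (suc (suc s)) 0            ∎
negBinom-absorption (suc s) (suc n) = begin
  suc (suc n) * negBinom (suc s) (suc (suc n))  ≡⟨ cong (suc (suc n) *_) (negBinom-pascal s (suc n)) ⟩
  suc (suc n) * (a + X)                         ≡⟨ *-distribˡ-+ (suc (suc n)) a X ⟩
  suc (suc n) * a + suc (suc n) * X             ≡⟨ cong (_+ suc (suc n) * X) (negBinom-absorption s (suc n)) ⟩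
  s * X + (X + suc n * X)                       ≡⟨ cong (λ b → s * X + (X + b)) (negBinom-absorption (suc s) n) ⟩
  s * X + (X + suc s * Y)                       ≡⟨ sym (+-assoc (s * X) X (suc s * Y)) ⟩
  (s * X + X) + suc s * Y                       ≡⟨ cong (_+ suc s * Y) (+-comm (s * X) X) ⟩
  suc s * X + suc s * Y                         ≡⟨ sym (*-distribˡ-+ (suc s) X Y) ⟩
  suc s * (X + Y)                               ≡⟨ cong (suc s *_) (sym (negBinom-pascal (suc s) n)) ⟩
  suc s * negBinom (suc (suc s)) (suc n)        ∎
  where
  a = negBinom s (suc (suc n))
  X = negBinom (suc s) (suc n)
  Y = negBinom (suc (suc s)) n

p^t∣m*n⇒p^t∣n : ∀ {p m} → Prime p → ¬ p ∣ m → ∀ t n → p ^ t ∣ m * n → p ^ t ∣ n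
p^t∣m*n⇒p^t∣n pp p∤m zero    n _ = 1∣ n
p^t∣m*n⇒p^t∣n {p} {m} pp p∤m (suc t) n p^1+t∣mn
  with p^t∣m*n⇒p^t∣n pp p∤m t n (∣-trans (n∣m*n p) p^1+t∣mn)
... | divides z refl with euclidsLemma m z pp p∣mz
  where
  p∣mz : p ∣ m * z
  p∣mz = *-cancelʳ-∣ (p ^ t) {{m^n≢0 p t {{prime⇒nonZero pp}}}}
           (subst (p * p ^ t ∣_) (sym (*-assoc m z (p ^ t))) p^1+t∣mn)
... | inj₁ p∣m = ⊥-elim (p∤m p∣m)
... | inj₂ p∣z = *-pres-∣ p∣z ∣-refl

SupportedOnMultiplesOf : ℕ → Series → Set
SupportedOnMultiplesOf p f = ∀ n → ¬ p ∣ n → f n ≡ 0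

module _ {p : ℕ} where

  private
    ≡0⇒0∣ : ∀ {n} → n ≡ 0 → 0 ∣ n
    ≡0⇒0∣ refl = 0 ∣0

  one-supported : SupportedOnMultiplesOf p one
  one-supported zero    p∤0 = ⊥-elim (p∤0 (p ∣0))
  one-supported (suc n) _   = refl

  -- A coefficient vanishes iff 0 divides it, so this is ∣-⊛ with d = 0.
  ⊛-supported : ∀ {f g} → SupportedOnMultiplesOf p f → SupportedOnMultiplesOf p g →
                SupportedOnMultiplesOf p (f ⊛ g)
  ⊛-supported {f} {g} fs gs n p∤n = 0∣⇒≡0 (∣-⊛ f g n split)
    where
    split : ∀ i → i ≤ n → 0 ∣ f i ⊎ 0 ∣ g (n ∸ i)
    split i i≤n with p ∣? i
    ... | no p∤i = inj₁ (≡0⇒0∣ (fs i p∤i))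
    ... | yes p∣i = inj₂ (≡0⇒0∣ (gs (n ∸ i) λ p∣n∸i →
                      p∤n (subst (p ∣_) (m+[n∸m]≡n i≤n) (∣m∣n⇒∣m+n p∣i p∣n∸i))))

  powS-supported : ∀ {f} → SupportedOnMultiplesOf p f → ∀ s → SupportedOnMultiplesOf p (powS s f)
  powS-supported fs zero    = one-supported
  powS-supported fs (suc s) = ⊛-supported fs (powS-supported fs s)

  geomInv-supported : ∀ {q} → p ∣ q → SupportedOnMultiplesOf p (geomInv q)
  geomInv-supported {q} p∣q n p∤n with q ∣? n
  ... | yes q∣n = ⊥-elim (p∤n (∣-trans p∣q q∣n))
  ... | no _    = refl

module _ (p : ℕ) .{{_ : NonZero p}} (q : ℕ) where

  DividesAboveResidue : ℕ → Series → Set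
  DividesAboveResidue d f = ∀ m c → d < c → c < p → q ∣ f (c + m * p)

  same-residue : ∀ {c m i} → c < p → i ≤ c + m * p → p ∣ (c + m * p) ∸ i → i ≡ c + (i / p) * p
  same-residue {c} {m} {i} c<p i≤n (divides j n∸i≡jp) =
    trans (m≡m%n+[m/n]*n i p) (cong (_+ (i / p) * p) i%p≡c)
    where
    i%p≡c : i % p ≡ c
    i%p≡c = begin
      i % p                       ≡⟨ sym ([m+kn]%n≡m%n i j p) ⟩
      (i + j * p) % p             ≡⟨ cong (λ x → (i + x) % p) (sym n∸i≡jp) ⟩
      (i + (c + m * p ∸ i)) % p   ≡⟨ cong (_% p) (m+[n∸m]≡n i≤n) ⟩
      (c + m * p) % p             ≡⟨ [m+kn]%n≡m%n c m p ⟩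
      c % p                       ≡⟨ m<n⇒m%n≡m c<p ⟩
      c                           ∎

  ⊛-dividesAboveResidue : ∀ {d f g} → SupportedOnMultiplesOf p g →
                          DividesAboveResidue d f → DividesAboveResidue d (f ⊛ g)
  ⊛-dividesAboveResidue {d} {f} {g} gs fd m c d<c c<p = ∣-⊛ f g (c + m * p) split
    where
    split : ∀ i → i ≤ c + m * p → q ∣ f i ⊎ q ∣ g (c + m * p ∸ i)
    split i i≤n with p ∣? (c + m * p ∸ i)
    ... | no p∤n∸i = inj₂ (subst (q ∣_) (sym (gs (c + m * p ∸ i) p∤n∸i)) (q ∣0))
    ... | yes p∣n∸i = inj₁ (subst (λ x → q ∣ f x) (sym (same-residue {c} {m} {i} c<p i≤n p∣n∸i))
                               (fd (i / p) c d<c c<p))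

  prodUpTo-dividesAboveResidue : ∀ {d s} → DividesAboveResidue d (negBinom s) →
                                 ∀ M → DividesAboveResidue d (prodUpTo p s M)
  prodUpTo-dividesAboveResidue bd zero    = bd
  prodUpTo-dividesAboveResidue {d} {s} bd (suc M) =
    ⊛-dividesAboveResidue {d} {prodUpTo p s M} (powS-supported (geomInv-supported (m∣m*n (p ^ M))) s)
                          (prodUpTo-dividesAboveResidue bd M)

  negBinom-dividesAboveResidue-pred : ∀ {d s} → DividesAboveResidue d (negBinom (suc s)) →
                                      DividesAboveResidue (suc d) (negBinom s)
  negBinom-dividesAboveResidue-pred {d} {s} bd m (suc c) (s≤s d<c) c<p =
    ∣m+n∣m⇒∣n (subst (q ∣_) pascal (bd m (suc c) (m<n⇒m<1+n d<c) c<p))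
              (bd m c d<c (<⇒≤ c<p))
    where
    pascal : negBinom (suc s) (suc c + m * p) ≡ negBinom (suc s) (c + m * p) + negBinom s (suc c + m * p)
    pascal = trans (negBinom-pascal s (c + m * p)) (+-comm (negBinom s (suc c + m * p)) (negBinom (suc s) (c + m * p)))

module _ {p : ℕ} (pp : Prime p) (t : ℕ) {k : ℕ} (p^t∣k : p ^ t ∣ k) where

  private instance
    p≢0 : NonZero p
    p≢0 = prime⇒nonZero pp

  negBinom-dividesAboveResidue : DividesAboveResidue p (p ^ t) 0 (negBinom k)
  negBinom-dividesAboveResidue m (suc c) _ c<p =
    p^t∣m*n⇒p^t∣n pp p∤n t _ (subst (p ^ t ∣_) (sym (negBinom-absorption k (c + m * p))) (∣m⇒∣m*n _ p^t∣k))
    where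
    p∤n : ¬ p ∣ suc c + m * p
    p∤n p∣n = <⇒≱ c<p (∣⇒≤ (∣m+n∣m⇒∣n (subst (p ∣_) (+-comm (suc c) (m * p)) p∣n) (n∣m*n m)))

  negBinom-∸-dividesAboveResidue : ∀ d → d < p → d ≤ k → DividesAboveResidue p (p ^ t) d (negBinom (k ∸ d))
  negBinom-∸-dividesAboveResidue zero    _   _   = negBinom-dividesAboveResidue
  negBinom-∸-dividesAboveResidue (suc d) d<p d<k =
    negBinom-dividesAboveResidue-pred p (p ^ t) {d} {k ∸ suc d}
      (subst (DividesAboveResidue p (p ^ t) d ∘ negBinom) (+-∸-assoc 1 d<k)
        (negBinom-∸-dividesAboveResidue d (<⇒≤ d<p) (<⇒≤ d<k)))

A-≥ν-on-−1-residue : ∀ {p k r} → Prime p → r < p ∸ 1 → r ≤ k → ∀ m →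
                     ν[ p ] A p (k ∸ r) ((p ∸ 1) + m * p) ≥ν k
A-≥ν-on-−1-residue {zero}          _  ()
A-≥ν-on-−1-residue {p@(suc p')} {k} {r} pp r<p' r≤k m t p^t∣k =
  prodUpTo-dividesAboveResidue p (p ^ t) {r} {k ∸ r} (negBinom-∸-dividesAboveResidue pp t p^t∣k r (m<n⇒m<1+n r<p') r≤k)
    (p' + m * p) m p' r<p' ≤-refl

theorem3p2 : ∀ (p k r : ℕ) → Prime p → p ≢ 2 → 1 ≤ k → (p ^ 2) * (p ∸ 1) ∣ k →
    1 ≤ r → r ≤ p ∸ 2 →
    ∀ (N : ℕ) → ∃ λ n → N < n × ν[ p ] A p (k ∸ r) n ≥ν k
theorem3p2 zero          _ _ _ _ _ _ 1≤r r≤0 _ = ⊥-elim (<⇒≱ 1≤r r≤0)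
theorem3p2 (suc zero)    _ _ _ _ _ _ 1≤r r≤0 _ = ⊥-elim (<⇒≱ 1≤r r≤0)
theorem3p2 p@(suc (suc p'')) k@(suc _) r pp _ _ p²[p-1]∣k _ r≤p'' N =
  n , N<n , A-≥ν-on-−1-residue pp (s≤s r≤p'') r≤k (suc N)
  where
  n : ℕ
  n = (p ∸ 1) + suc N * p
  N<n : N < n
  N<n = ≤-trans (m≤m*n (suc N) p) (m≤n+m (suc N * p) (p ∸ 1))
  r≤k : r ≤ k
  r≤k = ≤-trans (≤-trans r≤p'' (m≤n+m p'' 2)) (∣⇒≤ (∣-trans (∣m⇒∣m*n (p ∸ 1) (m∣m*n (p ^ 1))) p²[p-1]∣k))
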